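{- For every tree $T$, $b_L(T)\le b(T)$.
   Context: For a finite simple graph $H$, a burning sequence is a sequence $(b_1,\dots,b_t)$ of vertices such that every vertex $v$ satisfies $d_H(v,b_i)\le t-i$ for some $i\in\{1,\dots,t\}$; $b(H)$ is the minimum length of a burning sequence. The line graph $L(G)$ has vertex set $E(G)$, two vertices adjacent iff the edges share an endpoint. The edge burning number of $G$ is $b_L(G)=b(L(G))$. -}

module Defs where

open import Data.Nat using (ℕ; zero; suc; _≤_; _∸_)
import Data.Fin as Fin
open import Data.Fin using (Fin; zero; suc; toℕ; inject₁; fromℕ) renaming (_<_ to _<ᶠ_)
open import Data.Bool using (Bool; true; false; T)
open import Data.Product using (Σ; ∃; _×_; _,_; proj₁; proj₂)
open import Data.Sum using (_⊎_; inj₁; inj₂)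
open import Relation.Binary.PropositionalEquality using (_≡_; _≢_; refl; sym; subst)
open import Relation.Nullary using (¬_)
open import Function.Definitions using (Injective)
open import Data.Empty using (⊥)

record Graph : Set₁ where
  field
    V         : Set
    Adj       : V → V → Set
    Adj-sym   : ∀ {u v} → Adj u v → Adj v u
    Adj-irr   : ∀ {u} → ¬ Adj u u

module _ (G : Graph) where
  open Graph G

  data Walk : V → V → ℕ → Set where
    here : ∀ {u} → Walk u u 0
    step : ∀ {u w v ℓ} → Adj u w → Walk w v ℓ → Walk u v (suc ℓ)

  DistLe : V → V → ℕ → Set
  DistLe u v k = ∃ λ ℓ → ℓ ≤ k × Walk u v ℓ

  -- (b_1,…,b_t) with b_{i+1} = b i (i : Fin t, 0-indexed):
  -- every vertex v has some i with d(v, b_{i+1}) ≤ t - (i+1).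
  IsBurningSeq : (t : ℕ) → (Fin t → V) → Set
  IsBurningSeq t b = ∀ v → ∃ λ (i : Fin t) → DistLe v (b i) (t ∸ suc (toℕ i))

  HasBurningSeq : ℕ → Set
  HasBurningSeq t = Σ (Fin t → V) (IsBurningSeq t)

  IsBurningNumber : ℕ → Set
  IsBurningNumber k = HasBurningSeq k × (∀ m → Data.Nat._<_ m k → ¬ HasBurningSeq m)

record FinGraph (n : ℕ) : Set where
  field
    adj     : Fin n → Fin n → Bool
    adj-sym : ∀ u v → adj u v ≡ adj v u
    adj-irr : ∀ u → adj u u ≡ false

module _ {n : ℕ} (G : FinGraph n) where
  open FinGraph G

  FAdj : Fin n → Fin n → Set
  FAdj u v = T (adj u v)

  private
    fsym : ∀ {u v} → FAdj u v → FAdj v u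
    fsym {u} {v} p = subst T (adj-sym u v) p

    firr : ∀ {u} → ¬ FAdj u u
    firr {u} p with adj u u | adj-irr u
    firr {u} () | false | refl

  toGraph : Graph
  toGraph = record { V = Fin n ; Adj = FAdj ; Adj-sym = fsym ; Adj-irr = firr }

  -- edges: unordered pairs {u,v}, represented uniquely by u < v
  Edge : Set
  Edge = Σ (Fin n × Fin n) λ p → proj₁ p <ᶠ proj₂ p × FAdj (proj₁ p) (proj₂ p)

  ends : Edge → Fin n × Fin n
  ends = proj₁

  ShareEnd : Edge → Edge → Set
  ShareEnd ((a , b) , _) ((c , d) , _) = (a ≡ c ⊎ a ≡ d) ⊎ (b ≡ c ⊎ b ≡ d)

  LAdj : Edge → Edge → Set
  LAdj e f = ends e ≢ ends f × ShareEnd e f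

  private
    share-sym : ∀ e f → ShareEnd e f → ShareEnd f e
    share-sym _ _ (inj₁ (inj₁ p)) = inj₁ (inj₁ (sym p))
    share-sym _ _ (inj₁ (inj₂ p)) = inj₂ (inj₁ (sym p))
    share-sym _ _ (inj₂ (inj₁ p)) = inj₁ (inj₂ (sym p))
    share-sym _ _ (inj₂ (inj₂ p)) = inj₂ (inj₂ (sym p))

    lsym : ∀ {e f} → LAdj e f → LAdj f e
    lsym {e} {f} (ne , s) = (λ eq → ne (sym eq)) , share-sym e f s

    lirr : ∀ {e} → ¬ LAdj e e
    lirr (ne , _) = ne refl

  lineGraph : Graph
  lineGraph = record { V = Edge ; Adj = LAdj ; Adj-sym = λ {e} {f} → lsym {e} {f} ; Adj-irr = λ {e} → lirr {e} }

  Connected : Set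
  Connected = ∀ u v → ∃ λ ℓ → Walk toGraph u v ℓ

  -- a cycle: distinct vertices c₀,…,c_{m+2} (length ≥ 3), consecutive ones
  -- adjacent, and the last adjacent to the first
  record Cycle : Set where
    field
      m      : ℕ
      c      : Fin (suc (suc (suc m))) → Fin n
      c-inj  : Injective _≡_ _≡_ c
      c-step : ∀ (i : Fin (suc (suc m))) → FAdj (c (inject₁ i)) (c (Fin.suc i))
      c-close : FAdj (c (fromℕ (suc (suc m)))) (c Fin.zero)

  Acyclic : Set
  Acyclic = ¬ Cycle

  -- a tree: connected acyclic graph (nonempty vertex set imposed in the statement)
  IsTree : Set
  IsTree = Connected × Acyclic

-- Root the tree at r and send every vertex v ≠ r to the edge joining v to its parent (r
-- itself goes to any edge at r). Every edge is the parent edge of its endpoint farther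
-- from r, so this map is onto E(T); adjacent vertices go to equal or adjacent edges, so it
-- does not increase distances. Hence the image of a burning sequence of T burns L(T).

module Submission where

open import Defs
open import Data.Nat using (ℕ; zero; suc; _+_; _≤_; _<_; z≤n; s≤s)
open import Data.Nat.Properties
  using (≤-trans; ≤-total; <-≤-trans; <-trans; <-irrefl; ≮⇒≥; m≤n⇒m≤1+n; n≤0⇒n≡0; anyUpTo?)
open import Data.Nat.Induction using (<-rec)
open import Data.Fin as Fin using (Fin; zero; suc; inject₁; fromℕ)
open import Data.Fin.Properties using (any?; <-cmp; suc-injective; <-irrelevant)
open import Data.Bool.Properties using (T-irrelevant)
open import Data.Product using (Σ; ∃; _×_; _,_; proj₁; proj₂)
open import Data.Product.Properties using (≡-dec)
open import Data.Sum using (_⊎_; inj₁; inj₂)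
open import Data.Empty using (⊥-elim)
open import Relation.Nullary using (¬_; Dec; yes; no)
open import Relation.Nullary.Decidable using (T?; _×-dec_)
open import Relation.Unary using (Decidable)
open import Relation.Binary.Definitions using (DecidableEquality; tri<; tri≈; tri>)
open import Relation.Binary.PropositionalEquality using (_≡_; _≢_; refl; sym; trans; cong; cong₂; subst)
open import Function using (_∘_; id)
open import Function.Definitions using (Injective)

Least : (ℕ → Set) → ℕ → Set
Least P ℓ = P ℓ × (∀ {j} → j < ℓ → ¬ P j)

least-witness : ∀ {P : ℕ → Set} → Decidable P → ∀ {N} → P N → ∃ (Least P)
least-witness {P} P? = <-rec (λ N → P N → ∃ (Least P)) search _
  where
  search : ∀ N → (∀ {j} → j < N → P j → ∃ (Least P)) → P N → ∃ (Least P)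
  search N below pN with anyUpTo? P? N
  ... | yes (j , j<N , pj) = below j<N pj
  ... | no none = N , pN , λ j<N pj → none (_ , j<N , pj)

IsWeakHomomorphism : (G H : Graph) → (Graph.V G → Graph.V H) → Set
IsWeakHomomorphism G H f = ∀ {u v} → Graph.Adj G u v → f u ≡ f v ⊎ Graph.Adj H (f u) (f v)

module _ {G H : Graph} {f : Graph.V G → Graph.V H} (hom : IsWeakHomomorphism G H f) where

  walk-map : ∀ {u v ℓ} → Walk G u v ℓ → DistLe H (f u) (f v) ℓ
  walk-map here = 0 , z≤n , here
  walk-map {v = v} (step a p) with walk-map p | hom a
  ... | ℓ , ℓ≤ , q | inj₁ fu≡fw = ℓ , m≤n⇒m≤1+n ℓ≤ , subst (λ y → Walk H y (f v) ℓ) (sym fu≡fw) q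
  ... | ℓ , ℓ≤ , q | inj₂ fu~fw = suc ℓ , s≤s ℓ≤ , step fu~fw q

  isBurningSeq-map : (∀ y → ∃ λ x → f x ≡ y) →
                     ∀ {t b} → IsBurningSeq G t b → IsBurningSeq H t (f ∘ b)
  isBurningSeq-map onto burns y with onto y
  ... | x , refl with burns x
  ...   | i , ℓ , ℓ≤ , p with walk-map p
  ...     | ℓ′ , ℓ′≤ , q = i , ℓ′ , ≤-trans ℓ′≤ ℓ≤ , q

burningNumber-minimal : ∀ {G k t} → IsBurningNumber G k → HasBurningSeq G t → k ≤ t
burningNumber-minimal (_ , below) burns = ≮⇒≥ (λ t<k → below _ t<k burns)

burningNumber-mono : ∀ {G H k k′} {f : Graph.V G → Graph.V H} →
                     IsWeakHomomorphism G H f → (∀ y → ∃ λ x → f x ≡ y) →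
                     IsBurningNumber G k → IsBurningNumber H k′ → k′ ≤ k
burningNumber-mono hom onto ((b , burns) , _) bH =
  burningNumber-minimal bH (_ , isBurningSeq-map hom onto burns)

hasBurningSeq-empty : ∀ {G} → ¬ Graph.V G → HasBurningSeq G 0
hasBurningSeq-empty empty = (λ ()) , λ v → ⊥-elim (empty v)

module _ (G : Graph) where
  open Graph G

  vertex : ∀ {u v ℓ} → Walk G u v ℓ → Fin (suc ℓ) → V
  vertex {u} _          zero    = u
  vertex     here       (suc ())
  vertex     (step _ p) (suc i) = vertex p i

  Simple : ∀ {u v ℓ} → Walk G u v ℓ → Set
  Simple p = Injective _≡_ _≡_ (vertex p)

  All : (V → Set) → ∀ {u v ℓ} → Walk G u v ℓ → Set
  All Q {u} here       = Q u
  All Q {u} (step _ p) = Q u × All Q p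

module _ {G : Graph} where
  open Graph G

  _⊆ᵛ_ : ∀ {u v ℓ u′ v′ ℓ′} → Walk G u v ℓ → Walk G u′ v′ ℓ′ → Set₁
  p ⊆ᵛ q = ∀ {Q} → All G Q q → All G Q p

  vertex-last : ∀ {u v ℓ} (p : Walk G u v ℓ) → vertex G p (fromℕ ℓ) ≡ v
  vertex-last here       = refl
  vertex-last (step _ p) = vertex-last p

  vertex-adj : ∀ {u v ℓ} (p : Walk G u v ℓ) (i : Fin ℓ) →
               Adj (vertex G p (inject₁ i)) (vertex G p (suc i))
  vertex-adj (step a here)       zero    = a
  vertex-adj (step a (step b p)) zero    = a
  vertex-adj (step _ p)          (suc i) = vertex-adj p i

  All-vertex : ∀ {Q u v ℓ} (p : Walk G u v ℓ) → All G Q p → ∀ i → Q (vertex G p i)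
  All-vertex here       q        zero    = q
  All-vertex (step _ p) (q , _)  zero    = q
  All-vertex (step _ p) (_ , qs) (suc i) = All-vertex p qs i

  All-map : ∀ {Q R : V → Set} → (∀ {z} → Q z → R z) →
            ∀ {u v ℓ} (p : Walk G u v ℓ) → All G Q p → All G R p
  All-map f here       q        = f q
  All-map f (step _ p) (q , qs) = f q , All-map f p qs

  append : ∀ {u v w k ℓ} → Walk G u v k → Walk G v w ℓ → Walk G u w (k + ℓ)
  append here       q = q
  append (step a p) q = step a (append p q)

  All-append : ∀ {Q u v w k ℓ} (p : Walk G u v k) (q : Walk G v w ℓ) →
               All G Q p → All G Q q → All G Q (append p q)
  All-append here       q _        qs = qs
  All-append (step _ p) q (x , ps) qs = x , All-append p q ps qs

  snoc : ∀ {u v w ℓ} → Walk G u v ℓ → Adj v w → Walk G u w (suc ℓ)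
  snoc here       b = step b here
  snoc (step a p) b = step a (snoc p b)

  All-snoc : ∀ {Q u v w ℓ} (p : Walk G u v ℓ) (b : Adj v w) → All G Q p → Q w → All G Q (snoc p b)
  All-snoc here       b q        qw = q , qw
  All-snoc (step _ p) b (q , qs) qw = q , All-snoc p b qs qw

  reverse : ∀ {u v ℓ} → Walk G u v ℓ → Walk G v u ℓ
  reverse here       = here
  reverse (step a p) = snoc (reverse p) (Adj-sym a)

  All-reverse : ∀ {Q u v ℓ} (p : Walk G u v ℓ) → All G Q p → All G Q (reverse p)
  All-reverse here       q        = q
  All-reverse (step a p) (q , qs) = All-snoc (reverse p) (Adj-sym a) (All-reverse p qs) q

  step-simple : ∀ {u w v ℓ} (a : Adj u w) (p : Walk G w v ℓ) →
                Simple G p → (∀ i → vertex G p i ≢ u) → Simple G (step a p)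
  step-simple a p simple new {zero}  {zero}  _  = refl
  step-simple a p simple new {zero}  {suc j} eq = ⊥-elim (new j (sym eq))
  step-simple a p simple new {suc i} {zero}  eq = ⊥-elim (new i eq)
  step-simple a p simple new {suc i} {suc j} eq = cong suc (simple eq)

  suffix : ∀ {u v ℓ} (p : Walk G u v ℓ) (i : Fin (suc ℓ)) →
           ∃ λ ℓ′ → Σ (Walk G (vertex G p i) v ℓ′) λ q → (Simple G p → Simple G q) × q ⊆ᵛ p
  suffix p          zero    = _ , p , id , id
  suffix (step _ p) (suc i) with suffix p i
  ... | ℓ′ , q , simple , q⊆p = ℓ′ , q , (λ s eq → simple (suc-injective ∘ s) eq) , q⊆p ∘ proj₂

  module _ (_≟_ : DecidableEquality V) where

    loop-erase : ∀ {u v ℓ} (p : Walk G u v ℓ) →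
                 ∃ λ ℓ′ → Σ (Walk G u v ℓ′) λ q → Simple G q × q ⊆ᵛ p
    loop-erase here = 0 , here , (λ { {zero} {zero} _ → refl }) , id
    loop-erase {u} (step a p) with loop-erase p
    ... | ℓ , q , simple , q⊆p with any? (λ i → vertex G q i ≟ u)
    ...   | yes (i , refl) with suffix q i
    ...     | ℓ′ , q′ , simple′ , q′⊆q = ℓ′ , q′ , simple′ simple , λ qs → q′⊆q (q⊆p (proj₂ qs))
    loop-erase {u} (step a p) | ℓ , q , simple , q⊆p | no u∉q =
      suc ℓ , step a q , step-simple a q simple (λ i eq → u∉q (i , eq)) ,
      λ (qu , qs) → qu , q⊆p qs

first-step : ∀ {G : Graph} {u v ℓ} → u ≢ v → Walk G u v ℓ → ∃ (Graph.Adj G u)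
first-step u≢v here       = ⊥-elim (u≢v refl)
first-step _   (step a _) = _ , a

module FiniteGraph {n : ℕ} (G : FinGraph n) where
  open FinGraph G

  G⁺ : Graph
  G⁺ = toGraph G

  walk? : ∀ ℓ u v → Dec (Walk G⁺ u v ℓ)
  walk? zero u v with u Fin.≟ v
  ... | yes refl = yes here
  ... | no u≢v = no λ { here → u≢v refl }
  walk? (suc ℓ) u v with any? (λ w → T? (adj u w) ×-dec walk? ℓ w v)
  ... | yes (w , a , p) = yes (step a p)
  ... | no none = no λ { (step a p) → none (_ , a , p) }

  -- The walk u x ⋯ w closes up through u into a cycle after loop erasure.
  acyclic⇒¬detour : Acyclic G → ∀ {u x w ℓ} → FAdj G u x → FAdj G u w → x ≢ w →
                    (p : Walk G⁺ x w ℓ) → ¬ All G⁺ (_≢ u) p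
  acyclic⇒¬detour acyclic {u} u~x u~w x≢w p avoids with loop-erase Fin._≟_ p
  ... | _ , here , _ , _ = x≢w refl
  ... | _ , q@(step {ℓ = m} _ _) , simple , q⊆p = acyclic record
    { m       = m
    ; c       = vertex G⁺ (step u~x q)
    ; c-inj   = step-simple u~x q simple (All-vertex q (q⊆p avoids))
    ; c-step  = vertex-adj (step u~x q)
    ; c-close = subst (λ z → FAdj G z u) (sym (vertex-last q)) (Graph.Adj-sym G⁺ u~w)
    }

  _∈ₑ_ : Fin n → Edge G → Set
  z ∈ₑ ((a , b) , _) = a ≡ z ⊎ b ≡ z

  ∈ₑ-share : ∀ {z} (e f : Edge G) → z ∈ₑ e → z ∈ₑ f → ShareEnd G e f
  ∈ₑ-share _ _ (inj₁ p) (inj₁ q) = inj₁ (inj₁ (trans p (sym q)))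
  ∈ₑ-share _ _ (inj₁ p) (inj₂ q) = inj₁ (inj₂ (trans p (sym q)))
  ∈ₑ-share _ _ (inj₂ p) (inj₁ q) = inj₂ (inj₁ (trans p (sym q)))
  ∈ₑ-share _ _ (inj₂ p) (inj₂ q) = inj₂ (inj₂ (trans p (sym q)))

  ends-injective : ∀ (e f : Edge G) → ends G e ≡ ends G f → e ≡ f
  ends-injective (p , lt , a) (.p , lt′ , a′) refl =
    cong₂ (λ l b → p , l , b) (<-irrelevant lt lt′) (T-irrelevant a a′)

  edge : ∀ {u x} → FAdj G u x → Edge G
  edge {u} {x} a with <-cmp u x
  ... | tri< u<x _ _ = (u , x) , u<x , a
  ... | tri≈ _ refl _ = ⊥-elim (Graph.Adj-irr G⁺ a)
  ... | tri> _ _ x<u = (x , u) , x<u , Graph.Adj-sym G⁺ a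

  ∈-edgeˡ : ∀ {u x} (a : FAdj G u x) → u ∈ₑ edge a
  ∈-edgeˡ {u} {x} a with <-cmp u x
  ... | tri< _ _ _ = inj₁ refl
  ... | tri≈ _ refl _ = ⊥-elim (Graph.Adj-irr G⁺ a)
  ... | tri> _ _ _ = inj₂ refl

  ∈-edgeʳ : ∀ {u x} (a : FAdj G u x) → x ∈ₑ edge a
  ∈-edgeʳ {u} {x} a with <-cmp u x
  ... | tri< _ _ _ = inj₂ refl
  ... | tri≈ _ refl _ = ⊥-elim (Graph.Adj-irr G⁺ a)
  ... | tri> _ _ _ = inj₁ refl

  edge-ends-< : ∀ {u x} (a : FAdj G u x) → u Fin.< x → ends G (edge a) ≡ (u , x)
  edge-ends-< {u} {x} a u<x with <-cmp u x
  ... | tri< _ _ _ = refl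
  ... | tri≈ _ refl _ = ⊥-elim (Graph.Adj-irr G⁺ a)
  ... | tri> u≮x _ _ = ⊥-elim (u≮x u<x)

  edge-ends-> : ∀ {u x} (a : FAdj G u x) → x Fin.< u → ends G (edge a) ≡ (x , u)
  edge-ends-> {u} {x} a x<u with <-cmp u x
  ... | tri< _ _ x≮u = ⊥-elim (x≮u x<u)
  ... | tri≈ _ refl _ = ⊥-elim (Graph.Adj-irr G⁺ a)
  ... | tri> _ _ _ = refl

module RootedTree {n : ℕ} (G : FinGraph n) (connected : Connected G) (acyclic : Acyclic G)
                  (r : Fin n) where
  open FiniteGraph G

  private
    closest : ∀ v → ∃ (Least (λ ℓ → Walk G⁺ v r ℓ))
    closest v = least-witness (λ ℓ → walk? ℓ v r) (proj₂ (connected v r))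

  abstract
    depth : Fin n → ℕ
    depth v = proj₁ (closest v)

    depth-walk : ∀ v → Walk G⁺ v r (depth v)
    depth-walk v = proj₁ (proj₂ (closest v))

    depth-minimal : ∀ {v ℓ} → Walk G⁺ v r ℓ → depth v ≤ ℓ
    depth-minimal {v} p = ≮⇒≥ (λ ℓ<d → proj₂ (proj₂ (closest v)) ℓ<d p)

  depth-root : depth r ≡ 0
  depth-root = n≤0⇒n≡0 (depth-minimal here)

  depth≡0⇒root : ∀ {v} → depth v ≡ 0 → v ≡ r
  depth≡0⇒root {v} d≡0 with subst (Walk G⁺ v r) d≡0 (depth-walk v)
  ... | here = refl

  next-toward-root : ∀ {x ℓ} → x ≢ r → Walk G⁺ x r ℓ → ∃ λ w → FAdj G x w × depth w < ℓ
  next-toward-root x≢r here       = ⊥-elim (x≢r refl)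
  next-toward-root x≢r (step a p) = _ , a , s≤s (depth-minimal p)

  parent : ∀ {x} → x ≢ r → ∃ λ w → FAdj G x w × depth w < depth x
  parent x≢r = next-toward-root x≢r (depth-walk _)

  depth-along : ∀ {y ℓ} (p : Walk G⁺ y r ℓ) → All G⁺ (λ z → depth z ≤ ℓ) p
  depth-along here       = depth-minimal here
  depth-along (step a p) = depth-minimal (step a p) , All-map m≤n⇒m≤1+n p (depth-along p)

  descent : ∀ x → ∃ λ ℓ → Σ (Walk G⁺ x r ℓ) (All G⁺ (λ z → z ≡ x ⊎ depth z < depth x))
  descent x = _ , depth-walk x , strictly-below (depth-walk x)
    where
    strictly-below : ∀ {ℓ} (q : Walk G⁺ x r ℓ) → All G⁺ (λ z → z ≡ x ⊎ depth z < ℓ) q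
    strictly-below here       = inj₁ refl
    strictly-below (step _ q) = inj₁ refl , All-map (inj₂ ∘ s≤s) q (depth-along q)

  -- x ⋯ r ⋯ w would be a detour around u: it stays strictly below depth u except at x.
  lower-neighbour-unique : ∀ {u x w} → FAdj G u x → FAdj G u w →
                           depth x ≤ depth u → depth w < depth u → x ≡ w
  lower-neighbour-unique {u} {x} {w} u~x u~w dx≤du dw<du with x Fin.≟ w
  ... | yes x≡w = x≡w
  ... | no x≢w with descent x | descent w
  ...   | _ , p , p-below | _ , q , q-below =
    ⊥-elim (acyclic⇒¬detour acyclic u~x u~w x≢w (append p (reverse q))
      (All-append p (reverse q) (All-map from-x p p-below)
                                (All-reverse q (All-map from-w q q-below))))
    where
    from-x : ∀ {z} → z ≡ x ⊎ depth z < depth x → z ≢ u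
    from-x (inj₁ refl) refl = Graph.Adj-irr G⁺ u~x
    from-x (inj₂ dz<dx) refl = <-irrefl refl (<-≤-trans dz<dx dx≤du)
    from-w : ∀ {z} → z ≡ w ⊎ depth z < depth w → z ≢ u
    from-w (inj₁ refl) refl = <-irrefl refl dw<du
    from-w (inj₂ dz<dw) refl = <-irrefl refl (<-trans dz<dw dw<du)

  module ParentEdge {c : Fin n} (r~c : FAdj G r c) where

    parentEdge : Fin n → Edge G
    parentEdge u with u Fin.≟ r
    ... | yes _   = edge r~c
    ... | no u≢r = edge (proj₁ (proj₂ (parent u≢r)))

    ∈-parentEdge : ∀ u → u ∈ₑ parentEdge u
    ∈-parentEdge u with u Fin.≟ r
    ... | yes refl = ∈-edgeˡ r~c
    ... | no u≢r  = ∈-edgeˡ _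

    parentEdge-lower : ∀ {u x} (u~x : FAdj G u x) → depth x ≤ depth u → parentEdge u ≡ edge u~x
    parentEdge-lower {u} {x} u~x dx≤du with u Fin.≟ r
    ... | yes refl = ⊥-elim (Graph.Adj-irr G⁺ (subst (FAdj G r) x≡r u~x))
      where
      x≡r : x ≡ r
      x≡r = depth≡0⇒root (n≤0⇒n≡0 (subst (depth x ≤_) depth-root dx≤du))
    ... | no u≢r with parent u≢r
    ...   | w , u~w , dw<du with lower-neighbour-unique u~x u~w dx≤du dw<du
    ...     | refl = cong edge (T-irrelevant u~w u~x)

    parentEdge-weakHom : IsWeakHomomorphism G⁺ (lineGraph G) parentEdge
    parentEdge-weakHom {u} {x} u~x with ≡-dec Fin._≟_ Fin._≟_ (ends G (parentEdge u)) (ends G (parentEdge x))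
    ... | yes same = inj₁ (ends-injective _ _ same)
    ... | no differ = inj₂ (differ , share (≤-total (depth x) (depth u)))
      where
      x~u : FAdj G x u
      x~u = Graph.Adj-sym G⁺ u~x
      share : depth x ≤ depth u ⊎ depth u ≤ depth x → ShareEnd G (parentEdge u) (parentEdge x)
      share (inj₁ dx≤du) = ∈ₑ-share (parentEdge u) (parentEdge x)
        (subst (x ∈ₑ_) (sym (parentEdge-lower u~x dx≤du)) (∈-edgeʳ u~x)) (∈-parentEdge x)
      share (inj₂ du≤dx) = ∈ₑ-share (parentEdge u) (parentEdge x)
        (∈-parentEdge u) (subst (u ∈ₑ_) (sym (parentEdge-lower x~u du≤dx)) (∈-edgeʳ x~u))

    parentEdge-onto : ∀ e → ∃ λ v → parentEdge v ≡ e
    parentEdge-onto ((a , b) , a<b , a~b) with ≤-total (depth a) (depth b)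
    ... | inj₁ da≤db = b , ends-injective _ _
            (trans (cong (ends G) (parentEdge-lower b~a da≤db)) (edge-ends-> b~a a<b))
      where
      b~a : FAdj G b a
      b~a = Graph.Adj-sym G⁺ a~b
    ... | inj₂ db≤da = a , ends-injective _ _
            (trans (cong (ends G) (parentEdge-lower a~b db≤da)) (edge-ends-< a~b a<b))

theorem6 : ∀ {n : ℕ} (T : FinGraph (suc n)) → IsTree T →
           ∀ (k k' : ℕ) → IsBurningNumber (toGraph T) k →
           IsBurningNumber (lineGraph T) k' → k' ≤ k
theorem6 {zero} T _ k k' _ bL = ≤-trans (burningNumber-minimal bL (hasBurningSeq-empty no-edge)) z≤n
  where
  no-edge : ¬ Edge T
  no-edge ((zero , zero) , () , _)
theorem6 {suc n} T (connected , acyclic) k k' bT bL =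
  burningNumber-mono parentEdge-weakHom parentEdge-onto bT bL
  where
  open RootedTree T connected acyclic zero
  open ParentEdge (proj₂ (first-step (λ ()) (proj₂ (connected zero (suc zero)))))
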